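{- Let $X$ be a nonempty set and $R$ a ring of functions $X\to\mathbb{Z}$ containing all constant functions. Let $\varphi(x_1,\dots,x_n,y)$ be an $\mathcal{L}^+_R$-formula with $R$-bounded quantifiers in which the variable $y$ does not occur as a bounded (quantified) variable of any $R$-bounded quantifier. Then there is an $\mathcal{L}^+_R$-formula $\widetilde{\varphi}(x_1,\dots,x_n,y')$ with $R$-bounded quantifiers which is normalized in $y'$, such that $\exists y\,\varphi(x_1,\dots,x_n,y)$ is logically equivalent to $\exists y'\,\widetilde{\varphi}(x_1,\dots,x_n,y')$.
   Context: Languages: $\mathcal{L}_{Pres}=\{0,1,<,-,+\}$; $\mathcal{L}^+_{Pres}=\mathcal{L}_{Pres}\cup\{D_n:n\in\mathbb{N}\}$ ($D_n$ = divisibility by $n$, $D_0$ always false); $\mathcal{L}^+_R=\mathcal{L}_{Pres}\cup\{f_\alpha:\alpha\in R\}\cup\{D_\alpha:\alpha\in R\}$, where $f_\alpha$ (written $\alpha\cdot s$) is scalar multiplication by $\alpha(t)$ and $D_\alpha$ is divisibility by $\alpha(t)$, for a parameter $t\in X$; $\alpha$ also denotes the term $f_\alpha(1)$. For $t\in X$, $\varphi_t$ is the $\mathcal{L}^+_{Pres}$-formula obtained by replacing $\alpha\cdot s$ by the $\alpha(t)$-fold sum of $s$ (negated if $\alpha(t)<0$, $0$ if $\alpha(t)=0$) and $D_\alpha(s)$ by $D_{\alpha(t)}(s)$ (false if $\alpha(t)=0$), interpreted in $\mathbb{Z}$. Two formulas are logically equivalent if for every $t\in X$ and all integer values of the free variables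 their translations $\varphi_t,\psi_t$ have the same truth value in $\mathbb{Z}$. $R$-bounded quantifiers are $\exists z\,[0\le z\le\alpha\wedge\theta]$ and $\forall z\,[0\le z\le\alpha\rightarrow\theta]$ with $\alpha\in R$; formulas with $R$-bounded quantifiers form the smallest class containing atomic formulas and closed under Boolean combinations and $R$-bounded quantifiers. A formula with $R$-bounded quantifiers is normalized in $y$ if it is built using only $\vee$, $\wedge$ and $R$-bounded quantifiers from basic formulas of the forms: $y<a$; $b<y$; $D_\alpha(y+c)$; $\neg D_\beta(y+d)$; and atomic or negated atomic formulas not involving $y$; where $a,b,c,d$ are $\mathcal{L}^+_R$-terms not containing $y$ and $\alpha,\beta\in R$. -}

module Defs where

open import Data.Nat using (ℕ; _≡ᵇ_)
open import Data.Bool using (if_then_else_)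
open import Data.Integer using (ℤ; +_; _+_; _*_; -_; _-_; _<_; _≤_)
open import Data.Integer.Divisibility using (_∣_)
open import Data.Product using (Σ; _×_)
open import Data.Sum using (_⊎_)
open import Data.Empty using (⊥)
open import Data.Unit using (⊤)
open import Relation.Nullary using (¬_)
open import Relation.Binary.PropositionalEquality using (_≡_)

record IsRingOfFunctions (X : Set) (R : (X → ℤ) → Set) : Set where
  field
    const : (c : ℤ) → R (λ _ → c)
    plus  : ∀ {f g} → R f → R g → R (λ x → f x + g x)
    neg   : ∀ {f} → R f → R (λ x → - f x)
    mult  : ∀ {f g} → R f → R g → R (λ x → f x * g x)

Var : Set
Var = ℕ

data Term {X : Set} (R : (X → ℤ) → Set) : Set where
  var   : Var → Term R
  `0    : Term R
  `1    : Term R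
  `neg  : Term R → Term R
  _`-_  : Term R → Term R → Term R
  _`+_  : Term R → Term R → Term R
  scal  : (α : X → ℤ) → R α → Term R → Term R

cst : {X : Set} {R : (X → ℤ) → Set} (α : X → ℤ) → R α → Term R
cst α r = scal α r `1

data Atom {X : Set} (R : (X → ℤ) → Set) : Set where
  _`<_ : Term R → Term R → Atom R
  _`=_ : Term R → Term R → Atom R
  D    : (α : X → ℤ) → R α → Term R → Atom R

data Formula {X : Set} (R : (X → ℤ) → Set) : Set where
  atom  : Atom R → Formula R
  `¬    : Formula R → Formula R
  _`∧_  : Formula R → Formula R → Formula R
  _`∨_  : Formula R → Formula R → Formula R
  bex   : (z : Var) (α : X → ℤ) → R α → Formula R → Formula R
  ball  : (z : Var) (α : X → ℤ) → R α → Formula R → Formula R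

module _ {X : Set} {R : (X → ℤ) → Set} where

  OccT : Var → Term R → Set
  OccT y (var w)     = y ≡ w
  OccT y `0          = ⊥
  OccT y `1          = ⊥
  OccT y (`neg s)    = OccT y s
  OccT y (s `- u)    = OccT y s ⊎ OccT y u
  OccT y (s `+ u)    = OccT y s ⊎ OccT y u
  OccT y (scal α _ s) = OccT y s

  OccA : Var → Atom R → Set
  OccA y (s `< u)  = OccT y s ⊎ OccT y u
  OccA y (s `= u)  = OccT y s ⊎ OccT y u
  OccA y (D α _ s) = OccT y s

  Free : Var → Formula R → Set
  Free y (atom A)      = OccA y A
  Free y (`¬ φ)        = Free y φ
  Free y (φ `∧ ψ)      = Free y φ ⊎ Free y ψ
  Free y (φ `∨ ψ)      = Free y φ ⊎ Free y ψ
  Free y (bex z _ _ θ)  = ¬ (y ≡ z) × Free y θ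
  Free y (ball z _ _ θ) = ¬ (y ≡ z) × Free y θ

  BoundVar : Var → Formula R → Set
  BoundVar y (atom A)       = ⊥
  BoundVar y (`¬ φ)         = BoundVar y φ
  BoundVar y (φ `∧ ψ)       = BoundVar y φ ⊎ BoundVar y ψ
  BoundVar y (φ `∨ ψ)       = BoundVar y φ ⊎ BoundVar y ψ
  BoundVar y (bex z _ _ θ)  = y ≡ z ⊎ BoundVar y θ
  BoundVar y (ball z _ _ θ) = y ≡ z ⊎ BoundVar y θ

  data Normalized (y : Var) : Formula R → Set where
    n-lt   : ∀ {a} → ¬ OccT y a → Normalized y (atom (var y `< a))
    n-gt   : ∀ {b} → ¬ OccT y b → Normalized y (atom (b `< var y))
    n-dvd  : ∀ {α} (r : R α) {c} → ¬ OccT y c →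
             Normalized y (atom (D α r (var y `+ c)))
    n-ndvd : ∀ {β} (r : R β) {d} → ¬ OccT y d →
             Normalized y (`¬ (atom (D β r (var y `+ d))))
    n-atom  : ∀ {A} → ¬ OccA y A → Normalized y (atom A)
    n-natom : ∀ {A} → ¬ OccA y A → Normalized y (`¬ (atom A))
    n-and  : ∀ {φ ψ} → Normalized y φ → Normalized y ψ → Normalized y (φ `∧ ψ)
    n-or   : ∀ {φ ψ} → Normalized y φ → Normalized y ψ → Normalized y (φ `∨ ψ)
    n-bex  : ∀ {z α} (r : R α) {θ} → ¬ (z ≡ y) → Normalized y θ →
             Normalized y (bex z α r θ)
    n-ball : ∀ {z α} (r : R α) {θ} → ¬ (z ≡ y) → Normalized y θ →
             Normalized y (ball z α r θ)

-- Semantics: the translation φ_t interpreted in ℤ, for parameter t ∈ X and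
-- valuation v of the variables.  α·s is interpreted as α(t)*s (the α(t)-fold
-- sum of s, negated if α(t)<0, 0 if α(t)=0); D_α(s) as "α(t) ≠ 0 and
-- α(t) divides s".

  Valuation : Set
  Valuation = Var → ℤ

  _[_↦_] : Valuation → Var → ℤ → Valuation
  (v [ z ↦ k ]) w = if w ≡ᵇ z then k else v w

  ⟦_⟧t : Term R → X → Valuation → ℤ
  ⟦ var w ⟧t t v      = v w
  ⟦ `0 ⟧t t v         = + 0
  ⟦ `1 ⟧t t v         = + 1
  ⟦ `neg s ⟧t t v     = - ⟦ s ⟧t t v
  ⟦ s `- u ⟧t t v     = ⟦ s ⟧t t v - ⟦ u ⟧t t v
  ⟦ s `+ u ⟧t t v     = ⟦ s ⟧t t v + ⟦ u ⟧t t v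
  ⟦ scal α _ s ⟧t t v = α t * ⟦ s ⟧t t v

  ⟦_⟧a : Atom R → X → Valuation → Set
  ⟦ s `< u ⟧a t v  = ⟦ s ⟧t t v < ⟦ u ⟧t t v
  ⟦ s `= u ⟧a t v  = ⟦ s ⟧t t v ≡ ⟦ u ⟧t t v
  ⟦ D α _ s ⟧a t v = ¬ (α t ≡ + 0) × (α t ∣ ⟦ s ⟧t t v)

  ⟦_⟧ : Formula R → X → Valuation → Set
  ⟦ atom A ⟧ t v  = ⟦ A ⟧a t v
  ⟦ `¬ φ ⟧ t v    = ¬ ⟦ φ ⟧ t v
  ⟦ φ `∧ ψ ⟧ t v  = ⟦ φ ⟧ t v × ⟦ ψ ⟧ t v
  ⟦ φ `∨ ψ ⟧ t v  = ⟦ φ ⟧ t v ⊎ ⟦ ψ ⟧ t v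
  ⟦ bex z α r θ ⟧ t v  =
    Σ ℤ λ k → (+ 0 ≤ k) × (k ≤ ⟦ cst α r ⟧t t v) × ⟦ θ ⟧ t (v [ z ↦ k ])
  ⟦ ball z α r θ ⟧ t v =
    (k : ℤ) → + 0 ≤ k → k ≤ ⟦ cst α r ⟧t t v → ⟦ θ ⟧ t (v [ z ↦ k ])

  ExistsSem : Var → Formula R → X → Valuation → Set
  ExistsSem y φ t v = Σ ℤ λ k → ⟦ φ ⟧ t (v [ y ↦ k ])

-- Every term is affine in y, c·y + e with c ∈ R and e free of y, so after pushing negations
-- down to atoms (bounded quantifiers over ℤ are decidable) φ becomes a positive combination of
-- literals c·y < e, D_α(c·y + e) and ¬D_α(c·y + e). A literal with a general coefficient c is
-- removed by splitting on the sign of c(t), which is expressed by y-free atoms. If c(t) = 0 the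
-- literal no longer involves y. If c(t) > 0, then ∃y ψ(y) is equivalent to ∃y′ (D_c(y′) ∧ ψ′(y′)),
-- where ψ′ reads the chosen literal at y′ = c·y and multiplies every other literal through by c,
-- so that it too becomes a literal in c·y; c(t) < 0 is the same with −c and −y′. Each such step lowers
-- the number of general coefficients, and once all coefficients are 0, 1 or −1 the formula is
-- written out in normalized form.

module Submission where

open import Defs
open import Data.Nat as ℕ using (ℕ; zero; suc; _≡ᵇ_; s≤s; z≤n)
import Data.Nat.Properties as ℕP
import Data.Nat.Divisibility as ℕD
open import Data.Integer as ℤ
  using (ℤ; +_; -[1+_]; +[1+_]; 0ℤ; 1ℤ; _+_; _*_; -_; _-_; _<_; _≤_; +≤+) renaming (suc to sucℤ)
import Data.Integer.Properties as ℤP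
open import Data.Integer.Divisibility using (_∣_; *-monoʳ-∣; *-cancelˡ-∣)
import Data.Integer.Divisibility.Signed as Signed
open import Data.Integer.Tactic.RingSolver using (solve-∀)
open import Data.Nat.Tactic.RingSolver using () renaming (solve-∀ to ℕ-solve-∀)
open import Data.Product using (Σ; ∃-syntax; _×_; _,_)
open import Data.Product.Function.NonDependent.Propositional using (_×-⇔_)
open import Data.Sum using (_⊎_; inj₁; inj₂; [_,_]; map₂; swap)
open import Data.Sum.Function.Propositional using (_⊎-⇔_)
open import Data.Empty using (⊥; ⊥-elim)
open import Data.Unit using (⊤; tt)
open import Data.Bool using (true; false)
open import Function.Base using (_∘_)
open import Function.Bundles using (_⇔_; mk⇔; Equivalence)
open import Function.Properties.Equivalence
  using () renaming (refl to ⇔-refl; sym to ⇔-sym; trans to ⇔-trans)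
open import Function.Properties.Inverse using (↔⇒⇔)
open import Function.Related.TypeIsomorphisms using (¬-cong-⇔; Σ-distribˡ-⊎)
open import Relation.Nullary using (¬_; Dec; yes; no)
open import Relation.Nullary.Decidable using (¬?; _×-dec_; _⊎-dec_; decidable-stable)
import Relation.Nullary.Decidable as Dec
open import Relation.Binary.PropositionalEquality
  using (_≡_; _≢_; refl; sym; trans; cong; cong₂; subst; subst₂; module ≡-Reasoning)
open import Relation.Binary.Definitions using (tri<; tri≈; tri>)

open Equivalence using (to; from)

subst-⇔ : ∀ {A : Set} (P : A → Set) {a b} → a ≡ b → P a ⇔ P b
subst-⇔ P refl = ⇔-refl

∃-cong : ∀ {P Q : ℤ → Set} → (∀ k → P k ⇔ Q k) → (∃[ k ] P k) ⇔ (∃[ k ] Q k)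
∃-cong P⇔Q = mk⇔ (λ (k , p) → k , to (P⇔Q k) p) (λ (k , q) → k , from (P⇔Q k) q)

∃-guard : ∀ {P : Set} {Q : ℤ → Set} → (∃[ k ] (P × Q k)) ⇔ (P × ∃[ k ] Q k)
∃-guard = mk⇔ (λ (k , p , q) → p , k , q) (λ (p , k , q) → k , p , q)

∃-distrib-⊎ : ∀ {P Q : ℤ → Set} → (∃[ k ] (P k ⊎ Q k)) ⇔ ((∃[ k ] P k) ⊎ (∃[ k ] Q k))
∃-distrib-⊎ = ↔⇒⇔ Σ-distribˡ-⊎

¬¬-⇔ : ∀ {A : Set} → Dec A → (¬ ¬ A) ⇔ A
¬¬-⇔ A? = mk⇔ (decidable-stable A?) (λ a ¬a → ¬a a)

¬×-⇔ : ∀ {A B : Set} → Dec A → (¬ (A × B)) ⇔ (¬ A ⊎ ¬ B)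
¬×-⇔ A? = mk⇔ (to′ A?) [ (λ ¬a (a , _) → ¬a a) , (λ ¬b (_ , b) → ¬b b) ]
  where
  to′ : ∀ {A B : Set} → Dec A → ¬ (A × B) → ¬ A ⊎ ¬ B
  to′ (yes a) ¬ab = inj₂ (λ b → ¬ab (a , b))
  to′ (no ¬a) _   = inj₁ ¬a

¬⊎-⇔ : ∀ {A B : Set} → (¬ (A ⊎ B)) ⇔ (¬ A × ¬ B)
¬⊎-⇔ = mk⇔ (λ ¬ab → (λ a → ¬ab (inj₁ a)) , (λ b → ¬ab (inj₂ b))) (λ (¬a , ¬b) → [ ¬a , ¬b ])

BoundedEx BoundedAll : (ℤ → Set) → ℤ → Set
BoundedEx P n = Σ ℤ λ k → (+ 0 ≤ k) × (k ≤ n) × P k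
BoundedAll P n = (k : ℤ) → + 0 ≤ k → k ≤ n → P k

BoundedEx-cong : ∀ {P Q : ℤ → Set} n → (∀ k → P k ⇔ Q k) → BoundedEx P n ⇔ BoundedEx Q n
BoundedEx-cong n P⇔Q = mk⇔ (λ (k , 0≤k , k≤n , p) → k , 0≤k , k≤n , to (P⇔Q k) p)
                           (λ (k , 0≤k , k≤n , q) → k , 0≤k , k≤n , from (P⇔Q k) q)

BoundedAll-cong : ∀ {P Q : ℤ → Set} n → (∀ k → P k ⇔ Q k) → BoundedAll P n ⇔ BoundedAll Q n
BoundedAll-cong n P⇔Q = mk⇔ (λ ∀P k 0≤k k≤n → to (P⇔Q k) (∀P k 0≤k k≤n))
                            (λ ∀Q k 0≤k k≤n → from (P⇔Q k) (∀Q k 0≤k k≤n))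

BoundedEx? : ∀ {P : ℤ → Set} → (∀ k → Dec (P k)) → ∀ n → Dec (BoundedEx P n)
BoundedEx? P? -[1+ n ] = no λ (k , 0≤k , k≤n , _) → ℤP.<⇒≱ ℤ.-<+ (ℤP.≤-trans 0≤k k≤n)
BoundedEx? {P} P? (+ n) = Dec.map below⇔bounded (ℕP.anyUpTo? (λ i → P? (+ i)) (suc n))
  where
  below⇔bounded : (∃[ i ] (i ℕ.< suc n × P (+ i))) ⇔ BoundedEx P (+ n)
  below⇔bounded = mk⇔ (λ { (i , s≤s i≤n , p) → + i , +≤+ z≤n , +≤+ i≤n , p }) from′
    where
    from′ : BoundedEx P (+ n) → ∃[ i ] (i ℕ.< suc n × P (+ i))
    from′ (+ i , _ , +≤+ i≤n , p) = i , s≤s i≤n , p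

¬BoundedEx-⇔ : ∀ (P : ℤ → Set) n → (¬ BoundedEx P n) ⇔ BoundedAll (λ k → ¬ P k) n
¬BoundedEx-⇔ P n = mk⇔ (λ ¬∃ k 0≤k k≤n p → ¬∃ (k , 0≤k , k≤n , p))
                       (λ ∀¬ (k , 0≤k , k≤n , p) → ∀¬ k 0≤k k≤n p)

¬BoundedAll-⇔ : ∀ {P : ℤ → Set} → (∀ k → Dec (P k)) → ∀ n →
                (¬ BoundedAll P n) ⇔ BoundedEx (λ k → ¬ P k) n
¬BoundedAll-⇔ {P} P? n = mk⇔ to′ (λ (k , 0≤k , k≤n , ¬p) ∀P → ¬p (∀P k 0≤k k≤n))
  where
  to′ : ¬ BoundedAll P n → BoundedEx (λ k → ¬ P k) n
  to′ ¬∀ with BoundedEx? (λ k → ¬? (P? k)) n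
  ... | yes ∃¬ = ∃¬
  ... | no ¬∃¬ = ⊥-elim (¬∀ λ k 0≤k k≤n → decidable-stable (P? k) (λ ¬p → ¬∃¬ (k , 0≤k , k≤n , ¬p)))

BoundedAll? : ∀ {P : ℤ → Set} → (∀ k → Dec (P k)) → ∀ n → Dec (BoundedAll P n)
BoundedAll? P? n = Dec.map (⇔-trans (¬BoundedEx-⇔ _ n) (BoundedAll-cong n λ k → ¬¬-⇔ (P? k)))
                           (¬? (BoundedEx? (λ k → ¬? (P? k)) n))

NonzeroDivides : ℤ → ℤ → Set
NonzeroDivides a i = a ≢ 0ℤ × a ∣ i

private
  [i+k]-k≡i : ∀ i k → i + k + - k ≡ i
  [i+k]-k≡i = solve-∀
  i*k≡k*i : ∀ i k → i * k ≡ k * i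
  i*k≡k*i = solve-∀

<-translate : ∀ {i j i′ j′} k → i + k ≡ i′ → j + k ≡ j′ → i < j ⇔ i′ < j′
<-translate {i} {j} k refl refl = mk⇔ (ℤP.+-monoˡ-< k)
  (λ i+k<j+k → subst₂ _<_ ([i+k]-k≡i i k) ([i+k]-k≡i j k) (ℤP.+-monoˡ-< (- k) i+k<j+k))

<-suc-⇔-≤ : ∀ {i j} → i < sucℤ j ⇔ i ≤ j
<-suc-⇔-≤ = mk⇔
  (λ i<1+j → ℤP.≮⇒≥ λ j<i → ℤP.<-irrefl refl (ℤP.<-≤-trans i<1+j (ℤP.i<j⇒suc[i]≤j j<i)))
  (λ i≤j → ℤP.≤-<-trans i≤j (ℤP.suc[i]≤j⇒i<j ℤP.≤-refl))

≮-⇔-≥ : ∀ {i j} → (¬ i < j) ⇔ j ≤ i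
≮-⇔-≥ = mk⇔ ℤP.≮⇒≥ ℤP.≤⇒≯

≡-⇔-≤×≥ : ∀ {i j} → i ≡ j ⇔ (i ≤ j × j ≤ i)
≡-⇔-≤×≥ = mk⇔ (λ { refl → ℤP.≤-refl , ℤP.≤-refl }) (λ (i≤j , j≤i) → ℤP.≤-antisym i≤j j≤i)

≢-⇔-<⊎> : ∀ {i j} → i ≢ j ⇔ (i < j ⊎ j < i)
≢-⇔-<⊎> {i} {j} = mk⇔ to′ [ ℤP.<⇒≢ , (λ j<i i≡j → ℤP.<⇒≢ j<i (sym i≡j)) ]
  where
  to′ : i ≢ j → i < j ⊎ j < i
  to′ i≢j with ℤP.<-cmp i j
  ... | tri< i<j _ _ = inj₁ i<j
  ... | tri≈ _ i≡j _ = ⊥-elim (i≢j i≡j)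
  ... | tri> _ _ j<i = inj₂ j<i

*-cancelˡ-<-⇔ : ∀ m → 0ℤ < m → ∀ i j → m * i < m * j ⇔ i < j
*-cancelˡ-<-⇔ (+ 0) (ℤ.+<+ ()) i j
*-cancelˡ-<-⇔ +[1+ n ] _ i j = mk⇔ (ℤP.*-cancelˡ-<-nonNeg +[1+ n ]) (ℤP.*-monoˡ-<-pos +[1+ n ])

sign-split-⇔ : ∀ {P Q₀ Q₊ Q₋ : Set} c →
  (c ≡ 0ℤ → Q₀ ⇔ P) → (0ℤ < c → Q₊ ⇔ P) → (c < 0ℤ → Q₋ ⇔ P) →
  P ⇔ ((c ≡ 0ℤ × Q₀) ⊎ ((0ℤ < c × Q₊) ⊎ (c < 0ℤ × Q₋)))
sign-split-⇔ {P} {Q₀} {Q₊} {Q₋} c Q₀⇔P Q₊⇔P Q₋⇔P = mk⇔ to′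
  [ (λ (c≡0 , q) → to (Q₀⇔P c≡0) q)
  , [ (λ (0<c , q) → to (Q₊⇔P 0<c) q) , (λ (c<0 , q) → to (Q₋⇔P c<0) q) ] ]
  where
  to′ : P → (c ≡ 0ℤ × Q₀) ⊎ ((0ℤ < c × Q₊) ⊎ (c < 0ℤ × Q₋))
  to′ p with ℤP.<-cmp c 0ℤ
  ... | tri< c<0 _ _ = inj₂ (inj₂ (c<0 , from (Q₋⇔P c<0) p))
  ... | tri≈ _ c≡0 _ = inj₁ (c≡0 , from (Q₀⇔P c≡0) p)
  ... | tri> _ _ 0<c = inj₂ (inj₁ (0<c , from (Q₊⇔P 0<c) p))

NonzeroDivides-*-cancelˡ-⇔ : ∀ m → m ≢ 0ℤ → ∀ a i → NonzeroDivides (m * a) (m * i) ⇔ NonzeroDivides a i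
NonzeroDivides-*-cancelˡ-⇔ m m≢0 a i = nonzero ×-⇔ mk⇔ (*-cancelˡ-∣ m {{ℤ.≢-nonZero m≢0}}) (*-monoʳ-∣ m)
  where
  nonzero : m * a ≢ 0ℤ ⇔ a ≢ 0ℤ
  nonzero = mk⇔ (λ ma≢0 a≡0 → ma≢0 (trans (cong (m *_) a≡0) (ℤP.*-zeroʳ m)))
                (λ a≢0 ma≡0 → [ m≢0 , a≢0 ] (ℤP.i*j≡0⇒i≡0∨j≡0 m ma≡0))

NonzeroDivides-neg-⇔ : ∀ a i → NonzeroDivides a (- i) ⇔ NonzeroDivides a i
NonzeroDivides-neg-⇔ a i = ⇔-refl ×-⇔ subst-⇔ (ℕD._∣_ ℤ.∣ a ∣) (ℤP.∣-i∣≡∣i∣ i)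

∃-multiple-⇔ : ∀ m (P : ℤ → Set) → m ≢ 0ℤ → (∃[ k ] (NonzeroDivides m k × P k)) ⇔ (∃[ k ] P (m * k))
∃-multiple-⇔ m P m≢0 =
  mk⇔ to′ (λ (k , p) → m * k , (m≢0 , Signed.∣⇒∣ᵤ (Signed.divides k (i*k≡k*i m k))) , p)
  where
  to′ : (∃[ k ] (NonzeroDivides m k × P k)) → ∃[ k ] P (m * k)
  to′ (k , (_ , m∣k) , p) with Signed.∣ᵤ⇒∣ m∣k
  ... | Signed.divides q k≡q*m = q , subst P (trans k≡q*m (i*k≡k*i q m)) p

module Normalisation {X : Set} {R : (X → ℤ) → Set} (isRing : IsRingOfFunctions X R) (y : Var) where

  open IsRingOfFunctions isRing

  -- The type of `_[_↦_]` does not mention X and R, so they have to be supplied explicitly.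
  infixl 10 _⟨_≔_⟩
  _⟨_≔_⟩ : (Var → ℤ) → Var → ℤ → Var → ℤ
  _⟨_≔_⟩ = _[_↦_] {X} {R}

  ⟨≔⟩-same : ∀ (v : Var → ℤ) z k → (v ⟨ z ≔ k ⟩) z ≡ k
  ⟨≔⟩-same v z k with z ≡ᵇ z | ℕP.≡⇒≡ᵇ z z refl
  ... | true  | _ = refl
  ... | false | ()

  ⟨≔⟩-other : ∀ (v : Var → ℤ) {w z} k → w ≢ z → (v ⟨ z ≔ k ⟩) w ≡ v w
  ⟨≔⟩-other v {w} {z} k w≢z with w ≡ᵇ z | ℕP.≡ᵇ⇒≡ w z
  ... | true  | w≡z = ⊥-elim (w≢z (w≡z _))
  ... | false | _   = refl

  AgreeOffY : (Var → ℤ) → (Var → ℤ) → Set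
  AgreeOffY u u′ = ∀ w → w ≢ y → u w ≡ u′ w

  AgreeOffY-⟨≔⟩ : ∀ {u u′} z j → AgreeOffY u u′ → AgreeOffY (u ⟨ z ≔ j ⟩) (u′ ⟨ z ≔ j ⟩)
  AgreeOffY-⟨≔⟩ z j agree w w≢y with w ≡ᵇ z
  ... | true  = refl
  ... | false = agree w w≢y

  ⟦⟧t-AgreeOffY : ∀ (s : Term R) t {u u′} → ¬ OccT y s → AgreeOffY u u′ → ⟦ s ⟧t t u ≡ ⟦ s ⟧t t u′
  ⟦⟧t-AgreeOffY (var w)      t y∉ agree = agree w (λ w≡y → y∉ (sym w≡y))
  ⟦⟧t-AgreeOffY `0           t y∉ agree = refl
  ⟦⟧t-AgreeOffY `1           t y∉ agree = refl
  ⟦⟧t-AgreeOffY (`neg s)     t y∉ agree = cong -_ (⟦⟧t-AgreeOffY s t y∉ agree)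
  ⟦⟧t-AgreeOffY (s `- u)     t y∉ agree =
    cong₂ _-_ (⟦⟧t-AgreeOffY s t (y∉ ∘ inj₁) agree) (⟦⟧t-AgreeOffY u t (y∉ ∘ inj₂) agree)
  ⟦⟧t-AgreeOffY (s `+ u)     t y∉ agree =
    cong₂ _+_ (⟦⟧t-AgreeOffY s t (y∉ ∘ inj₁) agree) (⟦⟧t-AgreeOffY u t (y∉ ∘ inj₂) agree)
  ⟦⟧t-AgreeOffY (scal α _ s) t y∉ agree = cong (α t *_) (⟦⟧t-AgreeOffY s t y∉ agree)

  -- Affine terms

  record AffineInY (s : Term R) : Set where
    field
      coeff   : X → ℤ
      coeff∈R : R coeff
      rest    : Term R
      y∉rest  : ¬ OccT y rest
      rest⊆s  : ∀ w → OccT w rest → OccT w s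
      ⟦⟧≡     : ∀ t v → ⟦ s ⟧t t v ≡ coeff t * v y + ⟦ rest ⟧t t v

  open AffineInY

  private
    k≡1*k+0 : ∀ k → k ≡ + 1 * k + + 0
    k≡1*k+0 = solve-∀
    e≡0*k+e : ∀ e k → e ≡ + 0 * k + e
    e≡0*k+e = solve-∀
    -[ck+e]≡ : ∀ c k e → - (c * k + e) ≡ - c * k + - e
    -[ck+e]≡ = solve-∀
    [ck+e]-[dk+f]≡ : ∀ c d k e f → (c * k + e) - (d * k + f) ≡ (c - d) * k + (e - f)
    [ck+e]-[dk+f]≡ = solve-∀
    [ck+e]+[dk+f]≡ : ∀ c d k e f → (c * k + e) + (d * k + f) ≡ (c + d) * k + (e + f)
    [ck+e]+[dk+f]≡ = solve-∀
    a*[ck+e]≡ : ∀ a c k e → a * (c * k + e) ≡ (a * c) * k + a * e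
    a*[ck+e]≡ = solve-∀

  constantInY : ∀ {s} e → ¬ OccT y e → (∀ w → OccT w e → OccT w s) →
                (∀ t v → ⟦ s ⟧t t v ≡ ⟦ e ⟧t t v) → AffineInY s
  constantInY e y∉e e⊆s s≡e = record
    { coeff = λ _ → + 0 ; coeff∈R = const (+ 0) ; rest = e ; y∉rest = y∉e ; rest⊆s = e⊆s
    ; ⟦⟧≡ = λ t v → trans (s≡e t v) (e≡0*k+e (⟦ e ⟧t t v) (v y)) }

  affine : (s : Term R) → AffineInY s
  affine (var w) with w ℕ.≟ y
  ... | yes refl = record
    { coeff = λ _ → + 1 ; coeff∈R = const (+ 1) ; rest = `0 ; y∉rest = λ () ; rest⊆s = λ _ ()
    ; ⟦⟧≡ = λ t v → k≡1*k+0 (v y) }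
  ... | no w≢y = constantInY (var w) (λ y≡w → w≢y (sym y≡w)) (λ _ o → o) (λ _ _ → refl)
  affine `0 = constantInY `0 (λ ()) (λ _ ()) (λ _ _ → refl)
  affine `1 = constantInY `1 (λ ()) (λ _ ()) (λ _ _ → refl)
  affine (`neg s) = record
    { coeff = λ x → - coeff A x ; coeff∈R = neg (coeff∈R A) ; rest = `neg (rest A) ; y∉rest = y∉rest A
    ; rest⊆s = rest⊆s A
    ; ⟦⟧≡ = λ t v → trans (cong -_ (⟦⟧≡ A t v)) (-[ck+e]≡ (coeff A t) (v y) _) }
    where
    A : AffineInY s
    A = affine s
  affine (s `- u) = record
    { coeff = λ x → coeff A x - coeff B x ; coeff∈R = plus (coeff∈R A) (neg (coeff∈R B))
    ; rest = rest A `- rest B ; y∉rest = [ y∉rest A , y∉rest B ]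
    ; rest⊆s = λ w → [ inj₁ ∘ rest⊆s A w , inj₂ ∘ rest⊆s B w ]
    ; ⟦⟧≡ = λ t v → trans (cong₂ _-_ (⟦⟧≡ A t v) (⟦⟧≡ B t v))
                          ([ck+e]-[dk+f]≡ (coeff A t) (coeff B t) (v y) _ _) }
    where
    A : AffineInY s
    A = affine s
    B : AffineInY u
    B = affine u
  affine (s `+ u) = record
    { coeff = λ x → coeff A x + coeff B x ; coeff∈R = plus (coeff∈R A) (coeff∈R B)
    ; rest = rest A `+ rest B ; y∉rest = [ y∉rest A , y∉rest B ]
    ; rest⊆s = λ w → [ inj₁ ∘ rest⊆s A w , inj₂ ∘ rest⊆s B w ]
    ; ⟦⟧≡ = λ t v → trans (cong₂ _+_ (⟦⟧≡ A t v) (⟦⟧≡ B t v))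
                          ([ck+e]+[dk+f]≡ (coeff A t) (coeff B t) (v y) _ _) }
    where
    A : AffineInY s
    A = affine s
    B : AffineInY u
    B = affine u
  affine (scal α r s) = record
    { coeff = λ x → α x * coeff A x ; coeff∈R = mult r (coeff∈R A) ; rest = scal α r (rest A)
    ; y∉rest = y∉rest A ; rest⊆s = rest⊆s A
    ; ⟦⟧≡ = λ t v → trans (cong (α t *_) (⟦⟧≡ A t v)) (a*[ck+e]≡ (α t) (coeff A t) (v y) _) }
    where
    A : AffineInY s
    A = affine s

  -- Formulas linear in y

  -- `lit c L` holds at k when the literal L holds of c(t)·k; the special coefficients are
  -- those for which this can be written with y itself in a normalized formula.
  data SpecialCoefficient : Set where
    zeroˢ oneˢ minus-oneˢ : SpecialCoefficient

  ⟦_⟧ˢ : SpecialCoefficient → ℤ → ℤ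
  ⟦ zeroˢ ⟧ˢ      k = + 0
  ⟦ oneˢ ⟧ˢ       k = k
  ⟦ minus-oneˢ ⟧ˢ k = - k

  data Coefficient : Set where
    special : SpecialCoefficient → Coefficient
    general : (c : X → ℤ) → R c → Coefficient

  ⟦_⟧ᶜ : Coefficient → X → ℤ → ℤ
  ⟦ special s ⟧ᶜ   t k = ⟦ s ⟧ˢ k
  ⟦ general c _ ⟧ᶜ t k = c t * k

  data Literal : Set where
    lt        : (e : Term R) → ¬ OccT y e → Literal
    dvd ndvd  : (α : X → ℤ) → R α → (e : Term R) → ¬ OccT y e → Literal

  ⟦_⟧ᴸ : Literal → X → (Var → ℤ) → ℤ → Set
  ⟦ lt e _ ⟧ᴸ       t v a = a < ⟦ e ⟧t t v
  ⟦ dvd α _ e _ ⟧ᴸ  t v a = NonzeroDivides (α t) (a + ⟦ e ⟧t t v)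
  ⟦ ndvd α _ e _ ⟧ᴸ t v a = ¬ NonzeroDivides (α t) (a + ⟦ e ⟧t t v)

  data LinFormula : Set where
    lit         : Coefficient → Literal → LinFormula
    _∧ˡ_ _∨ˡ_   : LinFormula → LinFormula → LinFormula
    bexˡ ballˡ  : (z : Var) (α : X → ℤ) → R α → z ≢ y → LinFormula → LinFormula

  ⟦_⟧ˡ : LinFormula → X → (Var → ℤ) → ℤ → Set
  ⟦ lit c L ⟧ˡ          t v k = ⟦ L ⟧ᴸ t v (⟦ c ⟧ᶜ t k)
  ⟦ φ ∧ˡ ψ ⟧ˡ           t v k = ⟦ φ ⟧ˡ t v k × ⟦ ψ ⟧ˡ t v k
  ⟦ φ ∨ˡ ψ ⟧ˡ           t v k = ⟦ φ ⟧ˡ t v k ⊎ ⟦ ψ ⟧ˡ t v k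
  ⟦ bexˡ z α _ _ θ ⟧ˡ   t v k = BoundedEx  (λ j → ⟦ θ ⟧ˡ t (v ⟨ z ≔ j ⟩) k) (α t * + 1)
  ⟦ ballˡ z α _ _ θ ⟧ˡ  t v k = BoundedAll (λ j → ⟦ θ ⟧ˡ t (v ⟨ z ≔ j ⟩) k) (α t * + 1)

  Freeᴸ : Var → Literal → Set
  Freeᴸ w (lt e _)       = OccT w e
  Freeᴸ w (dvd _ _ e _)  = OccT w e
  Freeᴸ w (ndvd _ _ e _) = OccT w e

  Freeˡ : Var → LinFormula → Set
  Freeˡ w (lit _ L)          = Freeᴸ w L
  Freeˡ w (φ ∧ˡ ψ)           = Freeˡ w φ ⊎ Freeˡ w ψ
  Freeˡ w (φ ∨ˡ ψ)           = Freeˡ w φ ⊎ Freeˡ w ψ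
  Freeˡ w (bexˡ z _ _ _ θ)   = w ≢ z × Freeˡ w θ
  Freeˡ w (ballˡ z _ _ _ θ)  = w ≢ z × Freeˡ w θ

  ⟦⟧ᴸ-AgreeOffY : ∀ L t {u u′} a → AgreeOffY u u′ → ⟦ L ⟧ᴸ t u a ⇔ ⟦ L ⟧ᴸ t u′ a
  ⟦⟧ᴸ-AgreeOffY (lt e y∉e)       t a agree =
    subst-⇔ (a <_) (⟦⟧t-AgreeOffY e t y∉e agree)
  ⟦⟧ᴸ-AgreeOffY (dvd α _ e y∉e)  t a agree =
    subst-⇔ (λ i → NonzeroDivides (α t) (a + i)) (⟦⟧t-AgreeOffY e t y∉e agree)
  ⟦⟧ᴸ-AgreeOffY (ndvd α _ e y∉e) t a agree =
    subst-⇔ (λ i → ¬ NonzeroDivides (α t) (a + i)) (⟦⟧t-AgreeOffY e t y∉e agree)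

  ⟦⟧ˡ-AgreeOffY : ∀ ψ t {u u′} k → AgreeOffY u u′ → ⟦ ψ ⟧ˡ t u k ⇔ ⟦ ψ ⟧ˡ t u′ k
  ⟦⟧ˡ-AgreeOffY (lit c L) t k agree = ⟦⟧ᴸ-AgreeOffY L t _ agree
  ⟦⟧ˡ-AgreeOffY (φ ∧ˡ ψ)  t k agree = ⟦⟧ˡ-AgreeOffY φ t k agree ×-⇔ ⟦⟧ˡ-AgreeOffY ψ t k agree
  ⟦⟧ˡ-AgreeOffY (φ ∨ˡ ψ)  t k agree = ⟦⟧ˡ-AgreeOffY φ t k agree ⊎-⇔ ⟦⟧ˡ-AgreeOffY ψ t k agree
  ⟦⟧ˡ-AgreeOffY (bexˡ z α _ _ θ) t k agree =
    BoundedEx-cong _ λ j → ⟦⟧ˡ-AgreeOffY θ t k (AgreeOffY-⟨≔⟩ z j agree)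
  ⟦⟧ˡ-AgreeOffY (ballˡ z α _ _ θ) t k agree =
    BoundedAll-cong _ λ j → ⟦⟧ˡ-AgreeOffY θ t k (AgreeOffY-⟨≔⟩ z j agree)

  ⟦⟧ˡ-under-⟨≔⟩ : ∀ ψ (P : (Var → ℤ) → Set) t ρ {z} → z ≢ y →
                  (∀ ρ′ → ⟦ ψ ⟧ˡ t ρ′ (ρ′ y) ⇔ P ρ′) →
                  ∀ j → ⟦ ψ ⟧ˡ t (ρ ⟨ z ≔ j ⟩) (ρ y) ⇔ P (ρ ⟨ z ≔ j ⟩)
  ⟦⟧ˡ-under-⟨≔⟩ ψ P t ρ z≢y ψ⇔P j =
    ⇔-trans (subst-⇔ (⟦ ψ ⟧ˡ t (ρ ⟨ _ ≔ j ⟩)) (sym (⟨≔⟩-other ρ j (z≢y ∘ sym)))) (ψ⇔P (ρ ⟨ _ ≔ j ⟩))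

  ∃⟦⟧ˡ-⇔-ExistsSem : ∀ ψ (φ : Formula R) t → (∀ u → ⟦ ψ ⟧ˡ t u (u y) ⇔ ⟦ φ ⟧ t u) →
                     ∀ v → (∃[ k ] ⟦ ψ ⟧ˡ t v k) ⇔ ExistsSem y φ t v
  ∃⟦⟧ˡ-⇔-ExistsSem ψ φ t ψ⇔φ v = ∃-cong λ k →
    ⇔-trans (⇔-sym (⟦⟧ˡ-AgreeOffY ψ t k λ w w≢y → ⟨≔⟩-other v k w≢y))
    (⇔-trans (subst-⇔ (⟦ ψ ⟧ˡ t (v ⟨ y ≔ k ⟩)) (sym (⟨≔⟩-same v y k)))
             (ψ⇔φ (v ⟨ y ≔ k ⟩)))

  scaleᴸ : (m : X → ℤ) → R m → Literal → Literal
  scaleᴸ m m∈R (lt e y∉e)       = lt (scal m m∈R e) y∉e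
  scaleᴸ m m∈R (dvd α r e y∉e)  = dvd (λ x → m x * α x) (mult m∈R r) (scal m m∈R e) y∉e
  scaleᴸ m m∈R (ndvd α r e y∉e) = ndvd (λ x → m x * α x) (mult m∈R r) (scal m m∈R e) y∉e

  scale : (m : X → ℤ) → R m → LinFormula → LinFormula
  scale m m∈R (lit c L)           = lit c (scaleᴸ m m∈R L)
  scale m m∈R (φ ∧ˡ ψ)            = scale m m∈R φ ∧ˡ scale m m∈R ψ
  scale m m∈R (φ ∨ˡ ψ)            = scale m m∈R φ ∨ˡ scale m m∈R ψ
  scale m m∈R (bexˡ z α r z≢y θ)  = bexˡ z α r z≢y (scale m m∈R θ)
  scale m m∈R (ballˡ z α r z≢y θ) = ballˡ z α r z≢y (scale m m∈R θ)

  private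
    ma+me≡m[a+e] : ∀ m a e → m * a + m * e ≡ m * (a + e)
    ma+me≡m[a+e] = solve-∀
    -[mk]≡m*-k : ∀ m k → - (m * k) ≡ m * - k
    -[mk]≡m*-k = solve-∀
    c[mk]≡m[ck] : ∀ c m k → c * (m * k) ≡ m * (c * k)
    c[mk]≡m[ck] = solve-∀

  ⟦⟧ᶜ-* : ∀ c t m k → ⟦ c ⟧ᶜ t (m * k) ≡ m * ⟦ c ⟧ᶜ t k
  ⟦⟧ᶜ-* (special zeroˢ)      t m k = sym (ℤP.*-zeroʳ m)
  ⟦⟧ᶜ-* (special oneˢ)       t m k = refl
  ⟦⟧ᶜ-* (special minus-oneˢ) t m k = -[mk]≡m*-k m k
  ⟦⟧ᶜ-* (general c _)        t m k = c[mk]≡m[ck] (c t) m k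

  NonzeroDivides-scale-⇔ : ∀ m → 0ℤ < m → ∀ α a e →
    NonzeroDivides (m * α) (m * a + m * e) ⇔ NonzeroDivides α (a + e)
  NonzeroDivides-scale-⇔ m 0<m α a e =
    ⇔-trans (subst-⇔ (NonzeroDivides (m * α)) (ma+me≡m[a+e] m a e))
            (NonzeroDivides-*-cancelˡ-⇔ m (ℤP.<⇒≢ 0<m ∘ sym) α (a + e))

  scaleᴸ-⇔ : ∀ m m∈R t → 0ℤ < m t → ∀ L v a → ⟦ scaleᴸ m m∈R L ⟧ᴸ t v (m t * a) ⇔ ⟦ L ⟧ᴸ t v a
  scaleᴸ-⇔ m _ t 0<m (lt e _)       v a = *-cancelˡ-<-⇔ (m t) 0<m a (⟦ e ⟧t t v)
  scaleᴸ-⇔ m _ t 0<m (dvd α _ e _)  v a = NonzeroDivides-scale-⇔ (m t) 0<m (α t) a (⟦ e ⟧t t v)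
  scaleᴸ-⇔ m _ t 0<m (ndvd α _ e _) v a =
    ¬-cong-⇔ (NonzeroDivides-scale-⇔ (m t) 0<m (α t) a (⟦ e ⟧t t v))

  scale-⇔ : ∀ m m∈R t → 0ℤ < m t → ∀ ψ v k → ⟦ scale m m∈R ψ ⟧ˡ t v (m t * k) ⇔ ⟦ ψ ⟧ˡ t v k
  scale-⇔ m m∈R t 0<m (lit c L) v k =
    ⇔-trans (subst-⇔ (⟦ scaleᴸ m m∈R L ⟧ᴸ t v) (⟦⟧ᶜ-* c t (m t) k))
            (scaleᴸ-⇔ m m∈R t 0<m L v (⟦ c ⟧ᶜ t k))
  scale-⇔ m m∈R t 0<m (φ ∧ˡ ψ) v k = scale-⇔ m m∈R t 0<m φ v k ×-⇔ scale-⇔ m m∈R t 0<m ψ v k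
  scale-⇔ m m∈R t 0<m (φ ∨ˡ ψ) v k = scale-⇔ m m∈R t 0<m φ v k ⊎-⇔ scale-⇔ m m∈R t 0<m ψ v k
  scale-⇔ m m∈R t 0<m (bexˡ z _ _ _ θ)  v k =
    BoundedEx-cong _ λ j → scale-⇔ m m∈R t 0<m θ (v ⟨ z ≔ j ⟩) k
  scale-⇔ m m∈R t 0<m (ballˡ z _ _ _ θ) v k =
    BoundedAll-cong _ λ j → scale-⇔ m m∈R t 0<m θ (v ⟨ z ≔ j ⟩) k

  Freeˡ-scale : ∀ m m∈R ψ w → Freeˡ w (scale m m∈R ψ) → Freeˡ w ψ
  Freeˡ-scale m m∈R (lit c (lt _ _))       w = λ o → o
  Freeˡ-scale m m∈R (lit c (dvd _ _ _ _))  w = λ o → o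
  Freeˡ-scale m m∈R (lit c (ndvd _ _ _ _)) w = λ o → o
  Freeˡ-scale m m∈R (φ ∧ˡ ψ) w = [ inj₁ ∘ Freeˡ-scale m m∈R φ w , inj₂ ∘ Freeˡ-scale m m∈R ψ w ]
  Freeˡ-scale m m∈R (φ ∨ˡ ψ) w = [ inj₁ ∘ Freeˡ-scale m m∈R φ w , inj₂ ∘ Freeˡ-scale m m∈R ψ w ]
  Freeˡ-scale m m∈R (bexˡ z _ _ _ θ)  w (w≢z , o) = w≢z , Freeˡ-scale m m∈R θ w o
  Freeˡ-scale m m∈R (ballˡ z _ _ _ θ) w (w≢z , o) = w≢z , Freeˡ-scale m m∈R θ w o

  -- Removing a general coefficient

  data Context : Set where
    hole        : Context
    _∧ˡ□_ _∨ˡ□_ : Context → LinFormula → Context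
    _□∧ˡ_ _□∨ˡ_ : LinFormula → Context → Context
    bexˡ□ ballˡ□ : (z : Var) (α : X → ℤ) → R α → z ≢ y → Context → Context

  plug : Context → LinFormula → LinFormula
  plug hole                θ = θ
  plug (C ∧ˡ□ ψ)           θ = plug C θ ∧ˡ ψ
  plug (C ∨ˡ□ ψ)           θ = plug C θ ∨ˡ ψ
  plug (φ □∧ˡ C)           θ = φ ∧ˡ plug C θ
  plug (φ □∨ˡ C)           θ = φ ∨ˡ plug C θ
  plug (bexˡ□ z α r p C)   θ = bexˡ z α r p (plug C θ)
  plug (ballˡ□ z α r p C)  θ = ballˡ z α r p (plug C θ)

  mapContext : (LinFormula → LinFormula) → Context → Context
  mapContext T hole               = hole
  mapContext T (C ∧ˡ□ ψ)          = mapContext T C ∧ˡ□ T ψ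
  mapContext T (C ∨ˡ□ ψ)          = mapContext T C ∨ˡ□ T ψ
  mapContext T (φ □∧ˡ C)          = T φ □∧ˡ mapContext T C
  mapContext T (φ □∨ˡ C)          = T φ □∨ˡ mapContext T C
  mapContext T (bexˡ□ z α r p C)  = bexˡ□ z α r p (mapContext T C)
  mapContext T (ballˡ□ z α r p C) = ballˡ□ z α r p (mapContext T C)

  plug-mapContext-⇔ : ∀ (T : LinFormula → LinFormula) (f : ℤ → ℤ) t →
    (∀ ψ u k → ⟦ T ψ ⟧ˡ t u (f k) ⇔ ⟦ ψ ⟧ˡ t u k) →
    ∀ {θ θ′} → (∀ u k → ⟦ θ′ ⟧ˡ t u (f k) ⇔ ⟦ θ ⟧ˡ t u k) →
    ∀ C u k → ⟦ plug (mapContext T C) θ′ ⟧ˡ t u (f k) ⇔ ⟦ plug C θ ⟧ˡ t u k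
  plug-mapContext-⇔ T f t T-⇔ {θ} {θ′} θ′-⇔ = go
    where
    go : ∀ C u k → ⟦ plug (mapContext T C) θ′ ⟧ˡ t u (f k) ⇔ ⟦ plug C θ ⟧ˡ t u k
    go hole               u k = θ′-⇔ u k
    go (C ∧ˡ□ ψ)          u k = go C u k ×-⇔ T-⇔ ψ u k
    go (C ∨ˡ□ ψ)          u k = go C u k ⊎-⇔ T-⇔ ψ u k
    go (φ □∧ˡ C)          u k = T-⇔ φ u k ×-⇔ go C u k
    go (φ □∨ˡ C)          u k = T-⇔ φ u k ⊎-⇔ go C u k
    go (bexˡ□ z _ _ _ C)  u k = BoundedEx-cong _ λ j → go C (u ⟨ z ≔ j ⟩) k
    go (ballˡ□ z _ _ _ C) u k = BoundedAll-cong _ λ j → go C (u ⟨ z ≔ j ⟩) k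

  Freeˡ-plug-mapContext : ∀ T → (∀ ψ w → Freeˡ w (T ψ) → Freeˡ w ψ) →
    ∀ {θ θ′} w → (Freeˡ w θ′ → Freeˡ w θ) →
    ∀ C → Freeˡ w (plug (mapContext T C) θ′) → Freeˡ w (plug C θ)
  Freeˡ-plug-mapContext T T-free {θ} {θ′} w θ′-free = go
    where
    go : ∀ C → Freeˡ w (plug (mapContext T C) θ′) → Freeˡ w (plug C θ)
    go hole               = θ′-free
    go (C ∧ˡ□ ψ)          = [ inj₁ ∘ go C , inj₂ ∘ T-free ψ w ]
    go (C ∨ˡ□ ψ)          = [ inj₁ ∘ go C , inj₂ ∘ T-free ψ w ]
    go (φ □∧ˡ C)          = [ inj₁ ∘ T-free φ w , inj₂ ∘ go C ]
    go (φ □∨ˡ C)          = [ inj₁ ∘ T-free φ w , inj₂ ∘ go C ]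
    go (bexˡ□ z _ _ _ C)  (w≢z , o) = w≢z , go C o
    go (ballˡ□ z _ _ _ C) (w≢z , o) = w≢z , go C o

  #general : LinFormula → ℕ
  #general (lit (special _) _)   = 0
  #general (lit (general _ _) _) = 1
  #general (φ ∧ˡ ψ)               = #general φ ℕ.+ #general ψ
  #general (φ ∨ˡ ψ)               = #general φ ℕ.+ #general ψ
  #general (bexˡ _ _ _ _ θ)       = #general θ
  #general (ballˡ _ _ _ _ θ)      = #general θ

  #general□ : Context → ℕ
  #general□ hole                = 0
  #general□ (C ∧ˡ□ ψ)           = #general□ C ℕ.+ #general ψ
  #general□ (C ∨ˡ□ ψ)           = #general□ C ℕ.+ #general ψ
  #general□ (φ □∧ˡ C)           = #general φ ℕ.+ #general□ C
  #general□ (φ □∨ˡ C)           = #general φ ℕ.+ #general□ C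
  #general□ (bexˡ□ _ _ _ _ C)   = #general□ C
  #general□ (ballˡ□ _ _ _ _ C)  = #general□ C

  private
    [a+b]+c≡[a+c]+b : ∀ a b c → (a ℕ.+ b) ℕ.+ c ≡ (a ℕ.+ c) ℕ.+ b
    [a+b]+c≡[a+c]+b = ℕ-solve-∀

  #general-plug : ∀ C θ → #general (plug C θ) ≡ #general□ C ℕ.+ #general θ
  #general-plug hole              θ = refl
  #general-plug (C ∧ˡ□ ψ)         θ =
    trans (cong (ℕ._+ #general ψ) (#general-plug C θ))
          ([a+b]+c≡[a+c]+b (#general□ C) (#general θ) (#general ψ))
  #general-plug (C ∨ˡ□ ψ)         θ =
    trans (cong (ℕ._+ #general ψ) (#general-plug C θ))
          ([a+b]+c≡[a+c]+b (#general□ C) (#general θ) (#general ψ))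
  #general-plug (φ □∧ˡ C)         θ =
    trans (cong (#general φ ℕ.+_) (#general-plug C θ))
          (sym (ℕP.+-assoc (#general φ) (#general□ C) (#general θ)))
  #general-plug (φ □∨ˡ C)         θ =
    trans (cong (#general φ ℕ.+_) (#general-plug C θ))
          (sym (ℕP.+-assoc (#general φ) (#general□ C) (#general θ)))
  #general-plug (bexˡ□ _ _ _ _ C)  θ = #general-plug C θ
  #general-plug (ballˡ□ _ _ _ _ C) θ = #general-plug C θ

  #general□-mapContext : ∀ T → (∀ ψ → #general (T ψ) ≡ #general ψ) →
                         ∀ C → #general□ (mapContext T C) ≡ #general□ C
  #general□-mapContext T T-# hole               = refl
  #general□-mapContext T T-# (C ∧ˡ□ ψ)          = cong₂ ℕ._+_ (#general□-mapContext T T-# C) (T-# ψ)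
  #general□-mapContext T T-# (C ∨ˡ□ ψ)          = cong₂ ℕ._+_ (#general□-mapContext T T-# C) (T-# ψ)
  #general□-mapContext T T-# (φ □∧ˡ C)          = cong₂ ℕ._+_ (T-# φ) (#general□-mapContext T T-# C)
  #general□-mapContext T T-# (φ □∨ˡ C)          = cong₂ ℕ._+_ (T-# φ) (#general□-mapContext T T-# C)
  #general□-mapContext T T-# (bexˡ□ _ _ _ _ C)  = #general□-mapContext T T-# C
  #general□-mapContext T T-# (ballˡ□ _ _ _ _ C) = #general□-mapContext T T-# C

  #general-scale : ∀ m m∈R ψ → #general (scale m m∈R ψ) ≡ #general ψ
  #general-scale m m∈R (lit (special _) _)   = refl
  #general-scale m m∈R (lit (general _ _) _) = refl
  #general-scale m m∈R (φ ∧ˡ ψ)          = cong₂ ℕ._+_ (#general-scale m m∈R φ) (#general-scale m m∈R ψ)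
  #general-scale m m∈R (φ ∨ˡ ψ)          = cong₂ ℕ._+_ (#general-scale m m∈R φ) (#general-scale m m∈R ψ)
  #general-scale m m∈R (bexˡ _ _ _ _ θ)  = #general-scale m m∈R θ
  #general-scale m m∈R (ballˡ _ _ _ _ θ) = #general-scale m m∈R θ

  #general-plug-special : ∀ T → (∀ ψ → #general (T ψ) ≡ #general ψ) → ∀ C θ → #general θ ≡ 0 →
                          #general (plug (mapContext T C) θ) ≡ #general□ C
  #general-plug-special T T-# C θ θ-# = begin
    #general (plug (mapContext T C) θ)             ≡⟨ #general-plug (mapContext T C) θ ⟩
    #general□ (mapContext T C) ℕ.+ #general θ      ≡⟨ cong₂ ℕ._+_ (#general□-mapContext T T-# C) θ-# ⟩
    #general□ C ℕ.+ 0                              ≡⟨ ℕP.+-identityʳ (#general□ C) ⟩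
    #general□ C                                    ∎
    where open ≡-Reasoning

  #general-focus : ∀ C c r L → #general (plug C (lit (general c r) L)) ≡ suc (#general□ C)
  #general-focus C c r L = trans (#general-plug C (lit (general c r) L)) (ℕP.+-comm (#general□ C) 1)

  NoGeneral : LinFormula → Set
  NoGeneral (lit (special _) _)   = ⊤
  NoGeneral (lit (general _ _) _) = ⊥
  NoGeneral (φ ∧ˡ ψ)              = NoGeneral φ × NoGeneral ψ
  NoGeneral (φ ∨ˡ ψ)              = NoGeneral φ × NoGeneral ψ
  NoGeneral (bexˡ _ _ _ _ θ)      = NoGeneral θ
  NoGeneral (ballˡ _ _ _ _ θ)     = NoGeneral θ

  data Focus : LinFormula → Set where
    allSpecial : ∀ {ψ} → NoGeneral ψ → Focus ψ
    hasGeneral : ∀ C c r L → Focus (plug C (lit (general c r) L))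

  focus : ∀ ψ → Focus ψ
  focus (lit (special _) _)   = allSpecial tt
  focus (lit (general c r) L) = hasGeneral hole c r L
  focus (φ ∧ˡ ψ) with focus φ | focus ψ
  ... | hasGeneral C c r L | _                  = hasGeneral (C ∧ˡ□ ψ) c r L
  ... | allSpecial nφ      | hasGeneral C c r L = hasGeneral (φ □∧ˡ C) c r L
  ... | allSpecial nφ      | allSpecial nψ      = allSpecial (nφ , nψ)
  focus (φ ∨ˡ ψ) with focus φ | focus ψ
  ... | hasGeneral C c r L | _                  = hasGeneral (C ∨ˡ□ ψ) c r L
  ... | allSpecial nφ      | hasGeneral C c r L = hasGeneral (φ □∨ˡ C) c r L
  ... | allSpecial nφ      | allSpecial nψ      = allSpecial (nφ , nψ)
  focus (bexˡ z α r z≢y θ) with focus θ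
  ... | hasGeneral C c r′ L = hasGeneral (bexˡ□ z α r z≢y C) c r′ L
  ... | allSpecial nθ       = allSpecial nθ
  focus (ballˡ z α r z≢y θ) with focus θ
  ... | hasGeneral C c r′ L = hasGeneral (ballˡ□ z α r z≢y C) c r′ L
  ... | allSpecial nθ       = allSpecial nθ

  ltAtom : SpecialCoefficient → Term R → Atom R
  ltAtom zeroˢ      e = `0 `< e
  ltAtom oneˢ       e = var y `< e
  ltAtom minus-oneˢ e = `neg e `< var y

  dvdAtom : SpecialCoefficient → (α : X → ℤ) → R α → Term R → Atom R
  dvdAtom zeroˢ      α r e = D α r e
  dvdAtom oneˢ       α r e = D α r (var y `+ e)
  dvdAtom minus-oneˢ α r e = D α r (var y `+ `neg e)

  literalFormula : SpecialCoefficient → Literal → Formula R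
  literalFormula s (lt e _)       = atom (ltAtom s e)
  literalFormula s (dvd α r e _)  = atom (dvdAtom s α r e)
  literalFormula s (ndvd α r e _) = `¬ (atom (dvdAtom s α r e))

  private
    -i+[-k+i]≡-k : ∀ i k → - i + (- k + i) ≡ - k
    -i+[-k+i]≡-k = solve-∀
    k+[-k+i]≡i : ∀ k i → k + (- k + i) ≡ i
    k+[-k+i]≡i = solve-∀
    -[k-i]≡-k+i : ∀ k i → - (k + - i) ≡ - k + i
    -[k-i]≡-k+i = solve-∀

  ltAtom-⇔ : ∀ s e t u → ⟦ ltAtom s e ⟧a t u ⇔ (⟦ s ⟧ˢ (u y) < ⟦ e ⟧t t u)
  ltAtom-⇔ zeroˢ      e t u = ⇔-refl
  ltAtom-⇔ oneˢ       e t u = ⇔-refl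
  ltAtom-⇔ minus-oneˢ e t u =
    <-translate (- u y + ⟦ e ⟧t t u) (-i+[-k+i]≡-k (⟦ e ⟧t t u) (u y)) (k+[-k+i]≡i (u y) (⟦ e ⟧t t u))

  dvdAtom-⇔ : ∀ s α r e t u → ⟦ dvdAtom s α r e ⟧a t u ⇔ NonzeroDivides (α t) (⟦ s ⟧ˢ (u y) + ⟦ e ⟧t t u)
  dvdAtom-⇔ zeroˢ      α r e t u = subst-⇔ (NonzeroDivides (α t)) (sym (ℤP.+-identityˡ (⟦ e ⟧t t u)))
  dvdAtom-⇔ oneˢ       α r e t u = ⇔-refl
  dvdAtom-⇔ minus-oneˢ α r e t u =
    ⇔-trans (⇔-sym (NonzeroDivides-neg-⇔ (α t) (u y + - ⟦ e ⟧t t u)))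
            (subst-⇔ (NonzeroDivides (α t)) (-[k-i]≡-k+i (u y) (⟦ e ⟧t t u)))

  literalFormula-⇔ : ∀ s L t u → ⟦ literalFormula s L ⟧ t u ⇔ ⟦ L ⟧ᴸ t u (⟦ s ⟧ˢ (u y))
  literalFormula-⇔ s (lt e _)       t u = ltAtom-⇔ s e t u
  literalFormula-⇔ s (dvd α r e _)  t u = dvdAtom-⇔ s α r e t u
  literalFormula-⇔ s (ndvd α r e _) t u = ¬-cong-⇔ (dvdAtom-⇔ s α r e t u)

  literalFormula-normalized : ∀ s L → Normalized y (literalFormula s L)
  literalFormula-normalized zeroˢ      (lt e y∉e)       = n-atom [ (λ ()) , y∉e ]
  literalFormula-normalized oneˢ       (lt e y∉e)       = n-lt y∉e
  literalFormula-normalized minus-oneˢ (lt e y∉e)       = n-gt y∉e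
  literalFormula-normalized zeroˢ      (dvd α r e y∉e)  = n-atom y∉e
  literalFormula-normalized oneˢ       (dvd α r e y∉e)  = n-dvd r y∉e
  literalFormula-normalized minus-oneˢ (dvd α r e y∉e)  = n-dvd r y∉e
  literalFormula-normalized zeroˢ      (ndvd α r e y∉e) = n-natom y∉e
  literalFormula-normalized oneˢ       (ndvd α r e y∉e) = n-ndvd r y∉e
  literalFormula-normalized minus-oneˢ (ndvd α r e y∉e) = n-ndvd r y∉e

  ltAtom-free : ∀ s e w → OccA w (ltAtom s e) → w ≡ y ⊎ OccT w e
  ltAtom-free zeroˢ      e w = [ (λ ()) , inj₂ ]
  ltAtom-free oneˢ       e w = [ inj₁ , inj₂ ]
  ltAtom-free minus-oneˢ e w = [ inj₂ , inj₁ ]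

  dvdAtom-free : ∀ s α r e w → OccA w (dvdAtom s α r e) → w ≡ y ⊎ OccT w e
  dvdAtom-free zeroˢ      α r e w = inj₂
  dvdAtom-free oneˢ       α r e w = [ inj₁ , inj₂ ]
  dvdAtom-free minus-oneˢ α r e w = [ inj₁ , inj₂ ]

  literalFormula-free : ∀ s L w → Free w (literalFormula s L) → w ≡ y ⊎ Freeᴸ w L
  literalFormula-free s (lt e _)       w = ltAtom-free s e w
  literalFormula-free s (dvd α r e _)  w = dvdAtom-free s α r e w
  literalFormula-free s (ndvd α r e _) w = dvdAtom-free s α r e w

  toFormula : (ψ : LinFormula) → NoGeneral ψ → Formula R
  toFormula (lit (special s) L)  _          = literalFormula s L
  toFormula (φ ∧ˡ ψ)             (nφ , nψ) = toFormula φ nφ `∧ toFormula ψ nψ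
  toFormula (φ ∨ˡ ψ)             (nφ , nψ) = toFormula φ nφ `∨ toFormula ψ nψ
  toFormula (bexˡ z α r _ θ)     nθ        = bex z α r (toFormula θ nθ)
  toFormula (ballˡ z α r _ θ)    nθ        = ball z α r (toFormula θ nθ)

  toFormula-normalized : ∀ ψ nψ → Normalized y (toFormula ψ nψ)
  toFormula-normalized (lit (special s) L) _         = literalFormula-normalized s L
  toFormula-normalized (φ ∧ˡ ψ)            (nφ , nψ) =
    n-and (toFormula-normalized φ nφ) (toFormula-normalized ψ nψ)
  toFormula-normalized (φ ∨ˡ ψ)            (nφ , nψ) =
    n-or (toFormula-normalized φ nφ) (toFormula-normalized ψ nψ)
  toFormula-normalized (bexˡ z α r z≢y θ)  nθ        = n-bex r z≢y (toFormula-normalized θ nθ)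
  toFormula-normalized (ballˡ z α r z≢y θ) nθ        = n-ball r z≢y (toFormula-normalized θ nθ)

  toFormula-⇔ : ∀ ψ nψ t u → ⟦ toFormula ψ nψ ⟧ t u ⇔ ⟦ ψ ⟧ˡ t u (u y)
  toFormula-⇔ (lit (special s) L) _         t u = literalFormula-⇔ s L t u
  toFormula-⇔ (φ ∧ˡ ψ)            (nφ , nψ) t u = toFormula-⇔ φ nφ t u ×-⇔ toFormula-⇔ ψ nψ t u
  toFormula-⇔ (φ ∨ˡ ψ)            (nφ , nψ) t u = toFormula-⇔ φ nφ t u ⊎-⇔ toFormula-⇔ ψ nψ t u
  toFormula-⇔ (bexˡ z α r z≢y θ)  nθ        t u = BoundedEx-cong _ λ j →
    ⇔-sym (⟦⟧ˡ-under-⟨≔⟩ θ (⟦ toFormula θ nθ ⟧ t) t u z≢y (⇔-sym ∘ toFormula-⇔ θ nθ t) j)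
  toFormula-⇔ (ballˡ z α r z≢y θ) nθ        t u = BoundedAll-cong _ λ j →
    ⇔-sym (⟦⟧ˡ-under-⟨≔⟩ θ (⟦ toFormula θ nθ ⟧ t) t u z≢y (⇔-sym ∘ toFormula-⇔ θ nθ t) j)

  toFormula-free : ∀ ψ nψ w → Free w (toFormula ψ nψ) → w ≡ y ⊎ Freeˡ w ψ
  toFormula-free (lit (special s) L) _         w = literalFormula-free s L w
  toFormula-free (φ ∧ˡ ψ)            (nφ , nψ) w =
    [ map₂ inj₁ ∘ toFormula-free φ nφ w , map₂ inj₂ ∘ toFormula-free ψ nψ w ]
  toFormula-free (φ ∨ˡ ψ)            (nφ , nψ) w =
    [ map₂ inj₁ ∘ toFormula-free φ nφ w , map₂ inj₂ ∘ toFormula-free ψ nψ w ]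
  toFormula-free (bexˡ z α r _ θ)    nθ        w (w≢z , o) = map₂ (w≢z ,_) (toFormula-free θ nθ w o)
  toFormula-free (ballˡ z α r _ θ)   nθ        w (w≢z , o) = map₂ (w≢z ,_) (toFormula-free θ nθ w o)

  record NormalForm (ψ : LinFormula) : Set where
    field
      formula    : Formula R
      normalized : Normalized y formula
      free⊆      : ∀ w → Free w formula → w ≡ y ⊎ Freeˡ w ψ
      exists-⇔   : ∀ t v → (∃[ k ] ⟦ ψ ⟧ˡ t v k) ⇔ ExistsSem y formula t v

  open NormalForm

  normalForm-noGeneral : ∀ ψ → NoGeneral ψ → NormalForm ψ
  normalForm-noGeneral ψ nψ = record
    { formula    = toFormula ψ nψ
    ; normalized = toFormula-normalized ψ nψ
    ; free⊆      = toFormula-free ψ nψ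
    ; exists-⇔   = λ t → ∃⟦⟧ˡ-⇔-ExistsSem ψ (toFormula ψ nψ) t (λ u → ⇔-sym (toFormula-⇔ ψ nψ t u)) }

  module Elimination (C : Context) (c : X → ℤ) (c∈R : R c) (L : Literal) where

    ψ : LinFormula
    ψ = plug C (lit (general c c∈R) L)

    scaled : (m : X → ℤ) → R m → LinFormula → LinFormula
    scaled m m∈R θ = lit (special oneˢ) (dvd m m∈R `0 λ ()) ∧ˡ plug (mapContext (scale m m∈R) C) θ

    ψ₀ ψ₊ ψ₋ : LinFormula
    ψ₀ = plug (mapContext (λ θ → θ) C) (lit (special zeroˢ) L)
    ψ₊ = scaled c c∈R (lit (special oneˢ) L)
    ψ₋ = scaled (λ x → - c x) (neg c∈R) (lit (special minus-oneˢ) L)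

    ψ₀-⇔ : ∀ t → c t ≡ 0ℤ → ∀ v k → ⟦ ψ₀ ⟧ˡ t v k ⇔ ⟦ ψ ⟧ˡ t v k
    ψ₀-⇔ t c≡0 = plug-mapContext-⇔ (λ θ → θ) (λ k → k) t (λ _ _ _ → ⇔-refl)
      (λ u k → subst-⇔ (⟦ L ⟧ᴸ t u) (cong (_* k) (sym c≡0))) C

    -- Substituting k′ = m(t)·k: the literals of C are multiplied through by m(t) so as to mention
    -- only k′, while θ must express the chosen literal in terms of k′.
    ∃scaled-⇔ : ∀ m m∈R t → 0ℤ < m t → ∀ θ →
      (∀ u k → ⟦ θ ⟧ˡ t u (m t * k) ⇔ ⟦ lit (general c c∈R) L ⟧ˡ t u k) →
      ∀ v → (∃[ k ] ⟦ scaled m m∈R θ ⟧ˡ t v k) ⇔ (∃[ k ] ⟦ ψ ⟧ˡ t v k)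
    ∃scaled-⇔ m m∈R t 0<m θ θ-⇔ v =
      ⇔-trans (∃-cong λ k → subst-⇔ (NonzeroDivides (m t)) (ℤP.+-identityʳ k) ×-⇔ ⇔-refl)
      (⇔-trans (∃-multiple-⇔ (m t) _ (ℤP.<⇒≢ 0<m ∘ sym))
               (∃-cong λ k → plug-mapContext-⇔ (scale m m∈R) (m t *_) t (scale-⇔ m m∈R t 0<m) θ-⇔ C v k))

    private
      -[-c*k]≡c*k : ∀ c k → - (- c * k) ≡ c * k
      -[-c*k]≡c*k = solve-∀

    ∃ψ₊-⇔ : ∀ t → 0ℤ < c t → ∀ v → (∃[ k ] ⟦ ψ₊ ⟧ˡ t v k) ⇔ (∃[ k ] ⟦ ψ ⟧ˡ t v k)
    ∃ψ₊-⇔ t 0<c = ∃scaled-⇔ c c∈R t 0<c _ λ _ _ → ⇔-refl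

    ∃ψ₋-⇔ : ∀ t → c t < 0ℤ → ∀ v → (∃[ k ] ⟦ ψ₋ ⟧ˡ t v k) ⇔ (∃[ k ] ⟦ ψ ⟧ˡ t v k)
    ∃ψ₋-⇔ t c<0 = ∃scaled-⇔ (λ x → - c x) (neg c∈R) t (ℤP.neg-mono-< c<0) _
      λ u k → subst-⇔ (⟦ L ⟧ᴸ t u) (-[-c*k]≡c*k (c t) k)

    #ψ₀ : #general ψ₀ ≡ #general□ C
    #ψ₀ = #general-plug-special (λ θ → θ) (λ _ → refl) C _ refl

    #ψ₊ : #general ψ₊ ≡ #general□ C
    #ψ₊ = #general-plug-special (scale c c∈R) (#general-scale c c∈R) C _ refl

    #ψ₋ : #general ψ₋ ≡ #general□ C
    #ψ₋ = #general-plug-special (scale _ (neg c∈R)) (#general-scale _ (neg c∈R)) C _ refl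

    eliminate : NormalForm ψ₀ → NormalForm ψ₊ → NormalForm ψ₋ → NormalForm ψ
    eliminate N₀ N₊ N₋ = record
      { formula    = χ
      ; normalized = n-or (n-and (n-atom [ (λ ()) , (λ ()) ]) (normalized N₀))
                          (n-or (n-and (n-atom [ (λ ()) , (λ ()) ]) (normalized N₊))
                                (n-and (n-atom [ (λ ()) , (λ ()) ]) (normalized N₋)))
      ; free⊆      = λ w → [ [ [ (λ ()) , (λ ()) ] , free₀ w ]
                           , [ [ [ (λ ()) , (λ ()) ] , free₊ w ] , [ [ (λ ()) , (λ ()) ] , free₋ w ] ] ]
      ; exists-⇔   = ∃ψ-⇔-∃χ
      }
      where
      χ : Formula R
      χ = (atom (cst c c∈R `= `0) `∧ formula N₀)
          `∨ ((atom (`0 `< cst c c∈R) `∧ formula N₊) `∨ (atom (cst c c∈R `< `0) `∧ formula N₋))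

      free₀ : ∀ w → Free w (formula N₀) → w ≡ y ⊎ Freeˡ w ψ
      free₀ w = map₂ (Freeˡ-plug-mapContext (λ θ → θ) (λ _ _ o → o) w (λ o → o) C) ∘ free⊆ N₀ w

      free± : ∀ m m∈R s w → (N : NormalForm (scaled m m∈R (lit (special s) L))) →
              Free w (formula N) → w ≡ y ⊎ Freeˡ w ψ
      free± m m∈R s w N =
        [ inj₁ , [ (λ ()) , inj₂ ∘ Freeˡ-plug-mapContext (scale m m∈R) (Freeˡ-scale m m∈R) w (λ o → o) C ] ]
        ∘ free⊆ N w

      free₊ : ∀ w → Free w (formula N₊) → w ≡ y ⊎ Freeˡ w ψ
      free₊ w = free± c c∈R oneˢ w N₊

      free₋ : ∀ w → Free w (formula N₋) → w ≡ y ⊎ Freeˡ w ψ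
      free₋ w = free± (λ x → - c x) (neg c∈R) minus-oneˢ w N₋

      ∃ψ-⇔-∃χ : ∀ t v → (∃[ k ] ⟦ ψ ⟧ˡ t v k) ⇔ ExistsSem y χ t v
      ∃ψ-⇔-∃χ t v = ⇔-trans ∃ψ-⇔-cases (⇔-sym ∃χ-⇔-cases)
        where
        Cases : Set
        Cases = (c t ≡ 0ℤ × ∃[ k ] ⟦ ψ₀ ⟧ˡ t v k)
                ⊎ ((0ℤ < c t × ∃[ k ] ⟦ ψ₊ ⟧ˡ t v k) ⊎ (c t < 0ℤ × ∃[ k ] ⟦ ψ₋ ⟧ˡ t v k))

        ∃ψ-⇔-cases : (∃[ k ] ⟦ ψ ⟧ˡ t v k) ⇔ Cases
        ∃ψ-⇔-cases = sign-split-⇔ (c t)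
          (λ c≡0 → ∃-cong (ψ₀-⇔ t c≡0 v)) (λ 0<c → ∃ψ₊-⇔ t 0<c v) (λ c<0 → ∃ψ₋-⇔ t c<0 v)

        case : ∀ {θ} (N : NormalForm θ) (G : ℤ → Set) →
               (∃[ k ] (G (c t * + 1) × ⟦ formula N ⟧ t (v ⟨ y ≔ k ⟩))) ⇔ (G (c t) × ∃[ k ] ⟦ θ ⟧ˡ t v k)
        case N G = ⇔-trans ∃-guard (subst-⇔ G (ℤP.*-identityʳ (c t)) ×-⇔ ⇔-sym (exists-⇔ N t v))

        ∃χ-⇔-cases : ExistsSem y χ t v ⇔ Cases
        ∃χ-⇔-cases = ⇔-trans ∃-distrib-⊎
          (case N₀ (_≡ 0ℤ) ⊎-⇔ ⇔-trans ∃-distrib-⊎ (case N₊ (0ℤ <_) ⊎-⇔ case N₋ (_< 0ℤ)))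

  normalForm : ∀ n ψ → #general ψ ≡ n → NormalForm ψ
  normalForm n ψ #ψ≡n with focus ψ
  normalForm n _ #ψ≡n | allSpecial nψ = normalForm-noGeneral _ nψ
  normalForm zero _ #ψ≡0 | hasGeneral C c c∈R L with () ← trans (sym (#general-focus C c c∈R L)) #ψ≡0
  normalForm (suc n) _ #ψ≡1+n | hasGeneral C c c∈R L =
    eliminate (normalForm n ψ₀ (trans #ψ₀ #C≡n))
              (normalForm n ψ₊ (trans #ψ₊ #C≡n))
              (normalForm n ψ₋ (trans #ψ₋ #C≡n))
    where
    open Elimination C c c∈R L
    #C≡n : #general□ C ≡ n
    #C≡n = ℕP.suc-injective (trans (sym (#general-focus C c c∈R L)) #ψ≡1+n)

  -- Negation normal form

  lessThan atMost : ∀ {s u} → AffineInY s → AffineInY u → LinFormula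
  lessThan A B = lit (general (λ x → coeff A x - coeff B x) (plus (coeff∈R A) (neg (coeff∈R B))))
                     (lt (rest B `- rest A) [ y∉rest B , y∉rest A ])
  atMost A B = lit (general (λ x → coeff A x - coeff B x) (plus (coeff∈R A) (neg (coeff∈R B))))
                   (lt (`1 `+ (rest B `- rest A)) [ (λ ()) , [ y∉rest B , y∉rest A ] ])

  private
    [a-b]k+[bk+e]≡ak+e : ∀ a b k e → (a - b) * k + (b * k + e) ≡ a * k + e
    [a-b]k+[bk+e]≡ak+e = solve-∀
    [f-e]+[bk+e]≡bk+f : ∀ f e b k → (f - e) + (b * k + e) ≡ b * k + f
    [f-e]+[bk+e]≡bk+f = solve-∀
    1+[f-e]+[bk+e]≡1+[bk+f] : ∀ f e b k → (1ℤ + (f - e)) + (b * k + e) ≡ 1ℤ + (b * k + f)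
    1+[f-e]+[bk+e]≡1+[bk+f] = solve-∀

  lessThan-⇔ : ∀ {s u} (A : AffineInY s) (B : AffineInY u) t ρ →
               ⟦ lessThan A B ⟧ˡ t ρ (ρ y) ⇔ ⟦ s ⟧t t ρ < ⟦ u ⟧t t ρ
  lessThan-⇔ A B t ρ = <-translate (coeff B t * ρ y + ⟦ rest A ⟧t t ρ)
    (trans ([a-b]k+[bk+e]≡ak+e (coeff A t) (coeff B t) (ρ y) _) (sym (⟦⟧≡ A t ρ)))
    (trans ([f-e]+[bk+e]≡bk+f (⟦ rest B ⟧t t ρ) (⟦ rest A ⟧t t ρ) (coeff B t) (ρ y)) (sym (⟦⟧≡ B t ρ)))

  atMost-⇔ : ∀ {s u} (A : AffineInY s) (B : AffineInY u) t ρ →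
             ⟦ atMost A B ⟧ˡ t ρ (ρ y) ⇔ ⟦ s ⟧t t ρ ≤ ⟦ u ⟧t t ρ
  atMost-⇔ A B t ρ = ⇔-trans (<-translate (coeff B t * ρ y + ⟦ rest A ⟧t t ρ)
    (trans ([a-b]k+[bk+e]≡ak+e (coeff A t) (coeff B t) (ρ y) _) (sym (⟦⟧≡ A t ρ)))
    (trans (1+[f-e]+[bk+e]≡1+[bk+f] (⟦ rest B ⟧t t ρ) (⟦ rest A ⟧t t ρ) (coeff B t) (ρ y))
           (cong sucℤ (sym (⟦⟧≡ B t ρ)))))
    <-suc-⇔-≤

  lessThan-free : ∀ {s u} (A : AffineInY s) (B : AffineInY u) w →
                  Freeˡ w (lessThan A B) → OccT w s ⊎ OccT w u
  lessThan-free A B w = [ inj₂ ∘ rest⊆s B w , inj₁ ∘ rest⊆s A w ]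

  atMost-free : ∀ {s u} (A : AffineInY s) (B : AffineInY u) w →
                Freeˡ w (atMost A B) → OccT w s ⊎ OccT w u
  atMost-free A B w = [ (λ ()) , lessThan-free A B w ]

  divisible notDivisible : (α : X → ℤ) → R α → ∀ {s} → AffineInY s → LinFormula
  divisible    α r A = lit (general (coeff A) (coeff∈R A)) (dvd α r (rest A) (y∉rest A))
  notDivisible α r A = lit (general (coeff A) (coeff∈R A)) (ndvd α r (rest A) (y∉rest A))

  atom⁺ atom⁻ : Atom R → LinFormula
  atom⁺ (s `< u)  = lessThan (affine s) (affine u)
  atom⁺ (s `= u)  = atMost (affine s) (affine u) ∧ˡ atMost (affine u) (affine s)
  atom⁺ (D α r s) = divisible α r (affine s)
  atom⁻ (s `< u)  = atMost (affine u) (affine s)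
  atom⁻ (s `= u)  = lessThan (affine s) (affine u) ∨ˡ lessThan (affine u) (affine s)
  atom⁻ (D α r s) = notDivisible α r (affine s)

  atom⁺-⇔ : ∀ A t ρ → ⟦ atom⁺ A ⟧ˡ t ρ (ρ y) ⇔ ⟦ A ⟧a t ρ
  atom⁺-⇔ (s `< u)  t ρ = lessThan-⇔ (affine s) (affine u) t ρ
  atom⁺-⇔ (s `= u)  t ρ =
    ⇔-trans (atMost-⇔ (affine s) (affine u) t ρ ×-⇔ atMost-⇔ (affine u) (affine s) t ρ)
            (⇔-sym ≡-⇔-≤×≥)
  atom⁺-⇔ (D α r s) t ρ = subst-⇔ (NonzeroDivides (α t)) (sym (⟦⟧≡ (affine s) t ρ))

  atom⁻-⇔ : ∀ A t ρ → ⟦ atom⁻ A ⟧ˡ t ρ (ρ y) ⇔ (¬ ⟦ A ⟧a t ρ)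
  atom⁻-⇔ (s `< u)  t ρ = ⇔-trans (atMost-⇔ (affine u) (affine s) t ρ) (⇔-sym ≮-⇔-≥)
  atom⁻-⇔ (s `= u)  t ρ =
    ⇔-trans (lessThan-⇔ (affine s) (affine u) t ρ ⊎-⇔ lessThan-⇔ (affine u) (affine s) t ρ)
            (⇔-sym ≢-⇔-<⊎>)
  atom⁻-⇔ (D α r s) t ρ = ¬-cong-⇔ (subst-⇔ (NonzeroDivides (α t)) (sym (⟦⟧≡ (affine s) t ρ)))

  atom⁺-free : ∀ A w → Freeˡ w (atom⁺ A) → OccA w A
  atom⁺-free (s `< u)  w = lessThan-free (affine s) (affine u) w
  atom⁺-free (s `= u)  w =
    [ atMost-free (affine s) (affine u) w , swap ∘ atMost-free (affine u) (affine s) w ]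
  atom⁺-free (D α r s) w = rest⊆s (affine s) w

  atom⁻-free : ∀ A w → Freeˡ w (atom⁻ A) → OccA w A
  atom⁻-free (s `< u)  w = swap ∘ atMost-free (affine u) (affine s) w
  atom⁻-free (s `= u)  w =
    [ lessThan-free (affine s) (affine u) w , swap ∘ lessThan-free (affine u) (affine s) w ]
  atom⁻-free (D α r s) w = rest⊆s (affine s) w

  ⟦⟧-dec : ∀ (φ : Formula R) t ρ → Dec (⟦ φ ⟧ t ρ)
  ⟦⟧-dec (atom (s `< u))  t ρ = ⟦ s ⟧t t ρ ℤP.<? ⟦ u ⟧t t ρ
  ⟦⟧-dec (atom (s `= u))  t ρ = ⟦ s ⟧t t ρ ℤP.≟ ⟦ u ⟧t t ρ
  ⟦⟧-dec (atom (D α r s)) t ρ = ¬? (α t ℤP.≟ 0ℤ) ×-dec (ℤ.∣ α t ∣ ℕD.∣? ℤ.∣ ⟦ s ⟧t t ρ ∣)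
  ⟦⟧-dec (`¬ φ)           t ρ = ¬? (⟦⟧-dec φ t ρ)
  ⟦⟧-dec (φ `∧ ψ)         t ρ = ⟦⟧-dec φ t ρ ×-dec ⟦⟧-dec ψ t ρ
  ⟦⟧-dec (φ `∨ ψ)         t ρ = ⟦⟧-dec φ t ρ ⊎-dec ⟦⟧-dec ψ t ρ
  ⟦⟧-dec (bex z α r θ)    t ρ = BoundedEx? (λ j → ⟦⟧-dec θ t (ρ ⟨ z ≔ j ⟩)) (α t * + 1)
  ⟦⟧-dec (ball z α r θ)   t ρ = BoundedAll? (λ j → ⟦⟧-dec θ t (ρ ⟨ z ≔ j ⟩)) (α t * + 1)

  lin⁺ lin⁻ : (φ : Formula R) → ¬ BoundVar y φ → LinFormula
  lin⁺ (atom A)       _  = atom⁺ A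
  lin⁺ (`¬ φ)         nb = lin⁻ φ nb
  lin⁺ (φ `∧ ψ)       nb = lin⁺ φ (nb ∘ inj₁) ∧ˡ lin⁺ ψ (nb ∘ inj₂)
  lin⁺ (φ `∨ ψ)       nb = lin⁺ φ (nb ∘ inj₁) ∨ˡ lin⁺ ψ (nb ∘ inj₂)
  lin⁺ (bex z α r θ)  nb = bexˡ z α r (nb ∘ inj₁ ∘ sym) (lin⁺ θ (nb ∘ inj₂))
  lin⁺ (ball z α r θ) nb = ballˡ z α r (nb ∘ inj₁ ∘ sym) (lin⁺ θ (nb ∘ inj₂))
  lin⁻ (atom A)       _  = atom⁻ A
  lin⁻ (`¬ φ)         nb = lin⁺ φ nb
  lin⁻ (φ `∧ ψ)       nb = lin⁻ φ (nb ∘ inj₁) ∨ˡ lin⁻ ψ (nb ∘ inj₂)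
  lin⁻ (φ `∨ ψ)       nb = lin⁻ φ (nb ∘ inj₁) ∧ˡ lin⁻ ψ (nb ∘ inj₂)
  lin⁻ (bex z α r θ)  nb = ballˡ z α r (nb ∘ inj₁ ∘ sym) (lin⁻ θ (nb ∘ inj₂))
  lin⁻ (ball z α r θ) nb = bexˡ z α r (nb ∘ inj₁ ∘ sym) (lin⁻ θ (nb ∘ inj₂))

  lin⁺-⇔ : ∀ φ nb t ρ → ⟦ lin⁺ φ nb ⟧ˡ t ρ (ρ y) ⇔ ⟦ φ ⟧ t ρ
  lin⁻-⇔ : ∀ φ nb t ρ → ⟦ lin⁻ φ nb ⟧ˡ t ρ (ρ y) ⇔ (¬ ⟦ φ ⟧ t ρ)

  lin⁺-⇔ (atom A)       nb t ρ = atom⁺-⇔ A t ρ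
  lin⁺-⇔ (`¬ φ)         nb t ρ = lin⁻-⇔ φ nb t ρ
  lin⁺-⇔ (φ `∧ ψ)       nb t ρ = lin⁺-⇔ φ (nb ∘ inj₁) t ρ ×-⇔ lin⁺-⇔ ψ (nb ∘ inj₂) t ρ
  lin⁺-⇔ (φ `∨ ψ)       nb t ρ = lin⁺-⇔ φ (nb ∘ inj₁) t ρ ⊎-⇔ lin⁺-⇔ ψ (nb ∘ inj₂) t ρ
  lin⁺-⇔ (bex z α r θ)  nb t ρ = BoundedEx-cong _
    (⟦⟧ˡ-under-⟨≔⟩ (lin⁺ θ _) (⟦ θ ⟧ t) t ρ (nb ∘ inj₁ ∘ sym) (lin⁺-⇔ θ (nb ∘ inj₂) t))
  lin⁺-⇔ (ball z α r θ) nb t ρ = BoundedAll-cong _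
    (⟦⟧ˡ-under-⟨≔⟩ (lin⁺ θ _) (⟦ θ ⟧ t) t ρ (nb ∘ inj₁ ∘ sym) (lin⁺-⇔ θ (nb ∘ inj₂) t))
  lin⁻-⇔ (atom A)       nb t ρ = atom⁻-⇔ A t ρ
  lin⁻-⇔ (`¬ φ)         nb t ρ = ⇔-trans (lin⁺-⇔ φ nb t ρ) (⇔-sym (¬¬-⇔ (⟦⟧-dec φ t ρ)))
  lin⁻-⇔ (φ `∧ ψ)       nb t ρ =
    ⇔-trans (lin⁻-⇔ φ (nb ∘ inj₁) t ρ ⊎-⇔ lin⁻-⇔ ψ (nb ∘ inj₂) t ρ) (⇔-sym (¬×-⇔ (⟦⟧-dec φ t ρ)))
  lin⁻-⇔ (φ `∨ ψ)       nb t ρ =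
    ⇔-trans (lin⁻-⇔ φ (nb ∘ inj₁) t ρ ×-⇔ lin⁻-⇔ ψ (nb ∘ inj₂) t ρ) (⇔-sym ¬⊎-⇔)
  lin⁻-⇔ (bex z α r θ)  nb t ρ = ⇔-trans
    (BoundedAll-cong _ (⟦⟧ˡ-under-⟨≔⟩ (lin⁻ θ _) (¬_ ∘ ⟦ θ ⟧ t) t ρ (nb ∘ inj₁ ∘ sym) (lin⁻-⇔ θ (nb ∘ inj₂) t)))
    (⇔-sym (¬BoundedEx-⇔ _ _))
  lin⁻-⇔ (ball z α r θ) nb t ρ = ⇔-trans
    (BoundedEx-cong _ (⟦⟧ˡ-under-⟨≔⟩ (lin⁻ θ _) (¬_ ∘ ⟦ θ ⟧ t) t ρ (nb ∘ inj₁ ∘ sym) (lin⁻-⇔ θ (nb ∘ inj₂) t)))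
    (⇔-sym (¬BoundedAll-⇔ (λ j → ⟦⟧-dec θ t (ρ ⟨ z ≔ j ⟩)) _))

  lin⁺-free : ∀ φ nb w → Freeˡ w (lin⁺ φ nb) → Free w φ
  lin⁻-free : ∀ φ nb w → Freeˡ w (lin⁻ φ nb) → Free w φ
  lin⁺-free (atom A)       nb w = atom⁺-free A w
  lin⁺-free (`¬ φ)         nb w = lin⁻-free φ nb w
  lin⁺-free (φ `∧ ψ)       nb w = [ inj₁ ∘ lin⁺-free φ (nb ∘ inj₁) w , inj₂ ∘ lin⁺-free ψ (nb ∘ inj₂) w ]
  lin⁺-free (φ `∨ ψ)       nb w = [ inj₁ ∘ lin⁺-free φ (nb ∘ inj₁) w , inj₂ ∘ lin⁺-free ψ (nb ∘ inj₂) w ]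
  lin⁺-free (bex z α r θ)  nb w (w≢z , o) = w≢z , lin⁺-free θ (nb ∘ inj₂) w o
  lin⁺-free (ball z α r θ) nb w (w≢z , o) = w≢z , lin⁺-free θ (nb ∘ inj₂) w o
  lin⁻-free (atom A)       nb w = atom⁻-free A w
  lin⁻-free (`¬ φ)         nb w = lin⁺-free φ nb w
  lin⁻-free (φ `∧ ψ)       nb w = [ inj₁ ∘ lin⁻-free φ (nb ∘ inj₁) w , inj₂ ∘ lin⁻-free ψ (nb ∘ inj₂) w ]
  lin⁻-free (φ `∨ ψ)       nb w = [ inj₁ ∘ lin⁻-free φ (nb ∘ inj₁) w , inj₂ ∘ lin⁻-free ψ (nb ∘ inj₂) w ]
  lin⁻-free (bex z α r θ)  nb w (w≢z , o) = w≢z , lin⁻-free θ (nb ∘ inj₂) w o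
  lin⁻-free (ball z α r θ) nb w (w≢z , o) = w≢z , lin⁻-free θ (nb ∘ inj₂) w o

lemma3p2 : (X : Set) → X → (R : (X → ℤ) → Set) → IsRingOfFunctions X R →
    (φ : Formula R) (y : Var) → ¬ BoundVar y φ →
    Σ Var λ y′ → Σ (Formula R) λ φ~ →
      Normalized y′ φ~ ×
      (∀ w → Free w φ~ → w ≡ y′ ⊎ (Free w φ × ¬ (w ≡ y))) ×
      (¬ (y′ ≡ y) → ¬ Free y′ φ) ×
      ((t : X) (v : Var → ℤ) → ExistsSem y φ t v ⇔ ExistsSem y′ φ~ t v)
lemma3p2 X _ R isRing φ y y∉φ =
  y , formula , normalized , free , (λ y≢y → ⊥-elim (y≢y refl)) ,
  λ t v → ⇔-trans (⇔-sym (∃⟦⟧ˡ-⇔-ExistsSem ψ φ t (lin⁺-⇔ φ y∉φ t) v)) (exists-⇔ t v)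
  where
  open Normalisation isRing y
  ψ : LinFormula
  ψ = lin⁺ φ y∉φ
  N : NormalForm ψ
  N = normalForm _ ψ refl
  open NormalForm N
  free : ∀ w → Free w formula → w ≡ y ⊎ (Free w φ × w ≢ y)
  free w o with w ℕ.≟ y
  ... | yes w≡y = inj₁ w≡y
  ... | no w≢y  = map₂ (λ o′ → lin⁺-free φ y∉φ w o′ , w≢y) (free⊆ w o)
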